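{- Let $n\ge 3$ and let $0<a_1<\dots<a_n$ be real numbers. Let $\vec{C}=(c_1,\dots,c_n)$ be an optimal ordering of $a_1,\dots,a_n$ with partial sums $\vec{S}=(s_1,\dots,s_n)$, and suppose $c_k=a_n$ for some $1<k<n$. Then (1) for all $i,j$ with $1\le i<j\le k$, $\mu_{ij}(\vec{S})<\overline{S}$; and (2) for all $i,j$ with $k\le i<j\le n$, $\mu_{ij}(\vec{S})>\overline{S}$.
   Context: For an ordering $\vec{C}=(c_1,\dots,c_n)$ of $a_1,\dots,a_n$, its partial sums are $s_k=\sum_{i=1}^k c_i$, with mean $\overline{S}=\frac1n\sum_{k=1}^n s_k$, and $f(\vec{C})=\frac1n\sum_{k=1}^n (s_k-\overline{S})^2$. An ordering is optimal if it maximizes $f$ over all orderings. For $1\le i<j\le n+1$, the $(i,j)$-partial mean is $\mu_{ij}(\vec{S})=\frac{1}{j-i}\sum_{k=i}^{j-1}s_k$. -}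

module Defs where

open import Level using (Level; _⊔_) renaming (suc to lsuc)
open import Data.Nat as ℕ using (ℕ; zero; suc)
open import Data.Fin using (Fin; zero; suc; toℕ)
open import Data.Fin.Permutation using (Permutation′; _⟨$⟩ʳ_)
open import Data.Sum using (_⊎_)
open import Relation.Nullary using (¬_; yes; no)
open import Relation.Binary using (Rel; IsStrictTotalOrder)
open import Algebra.Core using (Op₁; Op₂)
open import Algebra.Structures using (IsCommutativeRing)

-- An ordered field (the real numbers are an instance).
record OrderedField c ℓ₁ ℓ₂ : Set (lsuc (c ⊔ ℓ₁ ⊔ ℓ₂)) where
  infix  4 _≈_ _<_
  infixl 6 _+_
  infixl 7 _*_
  infix  8 -_
  infix  9 _⁻¹
  field
    Carrier            : Set c
    _≈_                : Rel Carrier ℓ₁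
    _<_                : Rel Carrier ℓ₂
    _+_ _*_            : Op₂ Carrier
    -_                 : Op₁ Carrier
    0# 1#              : Carrier
    _⁻¹                : Op₁ Carrier
    isCommutativeRing  : IsCommutativeRing _≈_ _+_ _*_ -_ 0# 1#
    isStrictTotalOrder : IsStrictTotalOrder _≈_ _<_
    0<1                : 0# < 1#
    +-monoˡ-<          : ∀ {x y} z → x < y → x + z < y + z
    *-pos              : ∀ {x y} → 0# < x → 0# < y → 0# < x * y
    ⁻¹-inverse         : ∀ {x} → ¬ (x ≈ 0#) → x * x ⁻¹ ≈ 1#

  _≤_ : Rel Carrier (ℓ₁ ⊔ ℓ₂)
  x ≤ y = x < y ⊎ x ≈ y

  _-_ : Op₂ Carrier
  x - y = x + (- y)

  fromℕ : ℕ → Carrier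
  fromℕ zero    = 0#
  fromℕ (suc m) = 1# + fromℕ m

  ∑ : ∀ {n} → (Fin n → Carrier) → Carrier
  ∑ {zero}  f = 0#
  ∑ {suc n} f = f zero + ∑ (λ i → f (suc i))

  when : ∀ {p} {P : Set p} → Relation.Nullary.Dec P → Carrier → Carrier
  when (yes _) x = x
  when (no _)  x = 0#

  module Ordering {n : ℕ} (c : Fin n → Carrier) where
    -- Paper indices are 1-based: c_k (1 ≤ k ≤ n) is  c i  with  toℕ i + 1 = k.
    -- partial sum s_k = c_1 + ... + c_k, here s i = Σ_{toℕ j ≤ toℕ i} c j
    s : Fin n → Carrier
    s i = ∑ (λ j → when (toℕ j ℕ.≤? toℕ i) (c j))

    S̄ : Carrier
    S̄ = ∑ s * (fromℕ n) ⁻¹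

    f : Carrier
    f = ∑ (λ k → (s k - S̄) * (s k - S̄)) * (fromℕ n) ⁻¹

    -- (i,j)-partial mean, 1-based i, j:  μ_ij = (1/(j-i)) Σ_{k=i}^{j-1} s_k
    μ : ℕ → ℕ → Carrier
    μ i j = ∑ (λ k → when (i ℕ.≤? suc (toℕ k)) (when (suc (toℕ k) ℕ.<? j) (s k)))
            * (fromℕ (j ℕ.∸ i)) ⁻¹

  reorder : ∀ {n} → (Fin n → Carrier) → Permutation′ n → (Fin n → Carrier)
  reorder a π i = a (π ⟨$⟩ʳ i)

  Optimal : ∀ {n} → (Fin n → Carrier) → Permutation′ n → Set (ℓ₁ ⊔ ℓ₂)
  Optimal a π = ∀ ρ → Ordering.f (reorder a ρ) ≤ Ordering.f (reorder a π)

-- Swapping adjacent terms c_p, c_(p+1) changes only the partial sum s_p, by d = c_(p+1) - c_p,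
-- and n (f' - f) = 2d (s_p - S̄) + d² - d²/n.  In an optimal ordering this cannot be positive, so
-- around the position k of the largest term, s_(k-1) < S̄ (swap with c_(k-1), d > 0) and
-- s_k > S̄ (swap with c_(k+1), d < 0).  Partial sums of positive terms increase, hence
-- s_l < S̄ for l < k and s_l > S̄ for l ≥ k, and each partial mean of the theorem averages
-- partial sums from only one of these two ranges.
module Submission where

open import Defs
open import Algebra.Bundles using (CommutativeRing)
import Algebra.Solver.Ring
import Algebra.Solver.Ring.AlmostCommutativeRing as ACR
open import Data.Empty using (⊥-elim)
open import Data.Fin as Fin using (Fin; zero; suc; toℕ)
import Data.Fin.Properties as Finₚ
open import Data.Fin.Permutation as Perm using (Permutation′; _⟨$⟩ʳ_)
import Data.Fin.Permutation.Components as PC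
open import Data.Integer as ℤ using (ℤ; +_; -[1+_])
open import Data.Maybe using (Maybe; just; nothing)
open import Data.Nat as ℕ using (ℕ; zero; suc; _∸_; z≤n; s≤s; s≤s⁻¹; s<s; s<s⁻¹)
import Data.Integer.Properties as ℤₚ
import Data.Nat.Properties as ℕₚ
open import Data.Product using (_×_; _,_; ∃)
open import Data.Sign as Sign using (Sign)
open import Data.Sum using (_⊎_; inj₁; inj₂)
open import Function using (_∘_; const)
open import Function.Bundles using (Injection)
open import Function.Properties.Inverse using (Inverse⇒Injection)
open import Relation.Binary using (IsStrictTotalOrder; StrictPartialOrder; Tri; tri<; tri≈; tri>)
import Relation.Binary.Construct.StrictToNonStrict as NonStrict
import Relation.Binary.Reasoning.StrictPartialOrder as StrictReasoning
open import Relation.Binary.PropositionalEquality as ≡ using (_≡_; _≢_)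
open import Relation.Nullary using (¬_; Dec; yes; no)
open import Relation.Nullary.Decidable using (dec-true; dec-false)

adjacent⇒≢ : ∀ {n} {p q : Fin n} → toℕ q ≡ suc (toℕ p) → p ≢ q
adjacent⇒≢ q≡1+p p≡q = ℕₚ.1+n≢n (≡.sym (≡.trans (≡.cong toℕ p≡q) q≡1+p))

predecessor : ∀ {n} (k : Fin n) → 1 ℕ.≤ toℕ k → ∃ λ (j : Fin n) → toℕ k ≡ suc (toℕ j)
predecessor (suc j) _ = Fin.inject₁ j , ≡.cong suc (≡.sym (Finₚ.toℕ-inject₁ j))

successor : ∀ {n} (k : Fin n) → suc (toℕ k) ℕ.< n → ∃ λ (j : Fin n) → toℕ j ≡ suc (toℕ k)
successor k 1+k<n = Fin.fromℕ< 1+k<n , Finₚ.toℕ-fromℕ< 1+k<n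

-- Coefficients drawn from R itself would need a computable equality to normalise,
-- so the solver works with coefficients in ℤ mapped into R.
module IntegerCoefficientRingSolver {c ℓ} (R : CommutativeRing c ℓ) where
  open CommutativeRing R
  open import Algebra.Properties.Ring ring using (-1*x≈-x; -‿involutive; -0#≈0#; -‿+-comm)
  open import Algebra.Properties.CommutativeSemigroup +-commutativeSemigroup using (interchange)
  open import Algebra.Properties.CommutativeSemigroup *-commutativeSemigroup
    using () renaming (interchange to *-interchange)
  open import Algebra.Properties.Semiring.Mult semiring using (×-homo-+; ×1-homo-*) renaming (_×_ to _·_)
  open import Relation.Binary.Reasoning.Setoid setoid

  ⟦_⟧ : ℤ → Carrier
  ⟦ + n ⟧      = n · 1#
  ⟦ -[1+ n ] ⟧ = - (suc n · 1#)

  ⊖-homo : ∀ m n → ⟦ m ℤ.⊖ n ⟧ ≈ m · 1# - n · 1#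
  ⊖-homo m       zero    = trans (sym (+-identityʳ _)) (+-congˡ (sym -0#≈0#))
  ⊖-homo zero    (suc n) = sym (+-identityˡ _)
  ⊖-homo (suc m) (suc n) = begin
    ⟦ suc m ℤ.⊖ suc n ⟧              ≡⟨ ≡.cong ⟦_⟧ (ℤₚ.[1+m]⊖[1+n]≡m⊖n m n) ⟩
    ⟦ m ℤ.⊖ n ⟧                      ≈⟨ ⊖-homo m n ⟩
    m · 1# - n · 1#                  ≈⟨ +-identityˡ _ ⟨
    0# + (m · 1# - n · 1#)           ≈⟨ +-congʳ (-‿inverseʳ 1#) ⟨
    (1# - 1#) + (m · 1# - n · 1#)    ≈⟨ interchange 1# (- 1#) (m · 1#) (- (n · 1#)) ⟩
    (1# + m · 1#) + (- 1# + - (n · 1#)) ≈⟨ +-congˡ (-‿+-comm 1# (n · 1#)) ⟩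
    (1# + m · 1#) - (1# + n · 1#)    ∎

  +-homo : ∀ i j → ⟦ i ℤ.+ j ⟧ ≈ ⟦ i ⟧ + ⟦ j ⟧
  +-homo (+ m)    (+ n)    = ×-homo-+ 1# m n
  +-homo (+ m)    -[1+ n ] = ⊖-homo m (suc n)
  +-homo -[1+ m ] (+ n)    = trans (⊖-homo n (suc m)) (+-comm _ _)
  +-homo -[1+ m ] -[1+ n ] = begin
    - (suc (suc (m ℕ.+ n)) · 1#)     ≡⟨ ≡.cong (λ k → - (suc k · 1#)) (ℕₚ.+-suc m n) ⟨
    - ((suc m ℕ.+ suc n) · 1#)       ≈⟨ -‿cong (×-homo-+ 1# (suc m) (suc n)) ⟩
    - (suc m · 1# + suc n · 1#)      ≈⟨ -‿+-comm _ _ ⟨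
    - (suc m · 1#) + - (suc n · 1#)  ∎

  -‿homo : ∀ i → ⟦ ℤ.- i ⟧ ≈ - ⟦ i ⟧
  -‿homo (+ zero)  = sym -0#≈0#
  -‿homo (+ suc n) = refl
  -‿homo -[1+ n ]  = sym (-‿involutive _)

  ⟦_⟧ˢ : Sign → Carrier
  ⟦ Sign.+ ⟧ˢ = 1#
  ⟦ Sign.- ⟧ˢ = - 1#

  ◃-homo : ∀ s n → ⟦ s ℤ.◃ n ⟧ ≈ ⟦ s ⟧ˢ * (n · 1#)
  ◃-homo s      zero    = sym (zeroʳ _)
  ◃-homo Sign.+ (suc n) = sym (*-identityˡ _)
  ◃-homo Sign.- (suc n) = sym (-1*x≈-x _)

  sign-*-homo : ∀ s t → ⟦ s Sign.* t ⟧ˢ ≈ ⟦ s ⟧ˢ * ⟦ t ⟧ˢ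
  sign-*-homo Sign.+ t      = sym (*-identityˡ _)
  sign-*-homo Sign.- Sign.+ = sym (*-identityʳ _)
  sign-*-homo Sign.- Sign.- = sym (trans (-1*x≈-x (- 1#)) (-‿involutive 1#))

  sign-abs : ∀ i → ⟦ i ⟧ ≈ ⟦ ℤ.sign i ⟧ˢ * (ℤ.∣ i ∣ · 1#)
  sign-abs (+ n)    = sym (*-identityˡ _)
  sign-abs -[1+ n ] = ◃-homo Sign.- (suc n)

  *-homo : ∀ i j → ⟦ i ℤ.* j ⟧ ≈ ⟦ i ⟧ * ⟦ j ⟧
  *-homo i j = begin
    ⟦ (ℤ.sign i Sign.* ℤ.sign j) ℤ.◃ (ℤ.∣ i ∣ ℕ.* ℤ.∣ j ∣) ⟧
      ≈⟨ ◃-homo (ℤ.sign i Sign.* ℤ.sign j) (ℤ.∣ i ∣ ℕ.* ℤ.∣ j ∣) ⟩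
    ⟦ ℤ.sign i Sign.* ℤ.sign j ⟧ˢ * ((ℤ.∣ i ∣ ℕ.* ℤ.∣ j ∣) · 1#)
      ≈⟨ *-cong (sign-*-homo (ℤ.sign i) (ℤ.sign j)) (×1-homo-* ℤ.∣ i ∣ ℤ.∣ j ∣) ⟩
    (⟦ ℤ.sign i ⟧ˢ * ⟦ ℤ.sign j ⟧ˢ) * ((ℤ.∣ i ∣ · 1#) * (ℤ.∣ j ∣ · 1#))
      ≈⟨ *-interchange _ _ _ _ ⟩
    (⟦ ℤ.sign i ⟧ˢ * (ℤ.∣ i ∣ · 1#)) * (⟦ ℤ.sign j ⟧ˢ * (ℤ.∣ j ∣ · 1#))
      ≈⟨ *-cong (sign-abs i) (sign-abs j) ⟨
    ⟦ i ⟧ * ⟦ j ⟧ ∎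

  morphism : ℤ.+-*-rawRing ACR.-Raw-AlmostCommutative⟶ ACR.fromCommutativeRing R
  morphism = record
    { ⟦_⟧ = ⟦_⟧ ; +-homo = +-homo ; *-homo = *-homo ; -‿homo = -‿homo
    ; 0-homo = refl ; 1-homo = +-identityʳ 1# }

  ⟦⟧-≟ : ∀ i j → Maybe (⟦ i ⟧ ≈ ⟦ j ⟧)
  ⟦⟧-≟ i j with i ℤ.≟ j
  ... | yes i≡j = just (reflexive (≡.cong ⟦_⟧ i≡j))
  ... | no  _   = nothing

  open Algebra.Solver.Ring ℤ.+-*-rawRing (ACR.fromCommutativeRing R) morphism ⟦⟧-≟ public
    using (solve; _:=_; _:+_; _:*_; _:-_; :-_; con)

module _ {c ℓ₁ ℓ₂} (F : OrderedField c ℓ₁ ℓ₂) where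
  open OrderedField F

  commutativeRing : CommutativeRing c ℓ₁
  commutativeRing = record { isCommutativeRing = isCommutativeRing }

  open CommutativeRing commutativeRing
    using ( refl; sym; trans; reflexive; +-cong; +-congˡ; +-congʳ; *-cong; *-congˡ; *-congʳ
          ; +-identityˡ; +-identityʳ; *-identityˡ; *-identityʳ; zeroˡ; zeroʳ; distribˡ; distribʳ; +-assoc; *-assoc; +-comm; -‿cong; -‿inverseʳ )
  open IntegerCoefficientRingSolver commutativeRing using (solve; _:=_; _:+_; _:*_; _:-_; :-_; con)
  open IsStrictTotalOrder isStrictTotalOrder
    using (compare; <-respʳ-≈; <-respˡ-≈) renaming (trans to <-trans; irrefl to <-irrefl)

  strictPartialOrder : StrictPartialOrder c ℓ₁ ℓ₂
  strictPartialOrder = record { isStrictPartialOrder = IsStrictTotalOrder.isStrictPartialOrder isStrictTotalOrder }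

  open StrictReasoning strictPartialOrder

  sq : Carrier → Carrier
  sq x = x * x

  -- Ordered fields

  <-≤-trans : ∀ {x y z} → x < y → y ≤ z → x < z
  <-≤-trans = NonStrict.<-≤-trans _≈_ _<_ <-trans <-respʳ-≈

  ≤-<-trans : ∀ {x y z} → x ≤ y → y < z → x < z
  ≤-<-trans = NonStrict.≤-<-trans _≈_ _<_ sym <-trans <-respˡ-≈

  ≤-respʳ-≈ : ∀ {x y z} → y ≈ z → x ≤ y → x ≤ z
  ≤-respʳ-≈ = NonStrict.≤-respʳ-≈ _≈_ _<_ trans <-respʳ-≈

  <-or-≥ : ∀ x y → x < y ⊎ y ≤ x
  <-or-≥ x y with compare x y
  ... | tri< x<y _ _ = inj₁ x<y
  ... | tri≈ _ x≈y _ = inj₂ (inj₂ (sym x≈y))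
  ... | tri> _ _ y<x = inj₂ (inj₁ y<x)

  +-monoʳ-< : ∀ {x y} z → x < y → z + x < z + y
  +-monoʳ-< {x} {y} z x<y = <-respʳ-≈ (+-comm y z)
    (<-respˡ-≈ (+-comm x z) (+-monoˡ-< z x<y))

  +-mono-≤ : ∀ {x y u v} → x ≤ y → u ≤ v → (x + u) ≤ (y + v)
  +-mono-≤ {u = u} (inj₁ x<y) (inj₁ u<v) = inj₁ (<-trans (+-monoˡ-< u x<y) (+-monoʳ-< _ u<v))
  +-mono-≤ (inj₁ x<y) (inj₂ u≈v) = inj₁ (<-respʳ-≈ (+-congˡ u≈v) (+-monoˡ-< _ x<y))
  +-mono-≤ (inj₂ x≈y) (inj₁ u<v) = inj₁ (<-respˡ-≈ (+-congʳ (sym x≈y)) (+-monoʳ-< _ u<v))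
  +-mono-≤ (inj₂ x≈y) (inj₂ u≈v) = inj₂ (+-cong x≈y u≈v)

  +-mono-<-≤ : ∀ {x y u v} → x < y → u ≤ v → x + u < y + v
  +-mono-<-≤ {u = u} x<y u≤v = <-≤-trans (+-monoˡ-< u x<y) (+-mono-≤ (inj₂ refl) u≤v)

  +-mono-≤-< : ∀ {x y u v} → x ≤ y → u < v → x + u < y + v
  +-mono-≤-< {x} x≤y u<v = <-≤-trans (+-monoʳ-< x u<v) (+-mono-≤ x≤y (inj₂ refl))

  x<y⇒0<y-x : ∀ {x y} → x < y → 0# < y - x
  x<y⇒0<y-x {x} x<y = <-respˡ-≈ (-‿inverseʳ x) (+-monoˡ-< (- x) x<y)

  x≤y⇒0≤y-x : ∀ {x y} → x ≤ y → 0# ≤ (y - x)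
  x≤y⇒0≤y-x (inj₁ x<y) = inj₁ (x<y⇒0<y-x x<y)
  x≤y⇒0≤y-x {x} (inj₂ x≈y) = inj₂ (trans (sym (-‿inverseʳ x)) (+-congʳ x≈y))

  0<y-x⇒x<y : ∀ {x y} → 0# < y - x → x < y
  0<y-x⇒x<y {x} {y} 0<y-x = <-respˡ-≈ (+-identityˡ x) (<-respʳ-≈ (solve 2 (λ x y → ((y :- x) :+ x) := y) refl x y)
    (+-monoˡ-< x 0<y-x))

  *-monoʳ-< : ∀ {x y z} → 0# < z → x < y → x * z < y * z
  *-monoʳ-< {x} {y} {z} 0<z x<y = 0<y-x⇒x<y (<-respʳ-≈ (solve 3 (λ x y z → ((y :- x) :* z) := ((y :* z) :- (x :* z))) refl x y z)
    (*-pos (x<y⇒0<y-x x<y) 0<z))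

  *-nonneg : ∀ {x y} → 0# ≤ x → 0# ≤ y → 0# ≤ (x * y)
  *-nonneg (inj₁ 0<x) (inj₁ 0<y) = inj₁ (*-pos 0<x 0<y)
  *-nonneg {y = y} (inj₂ 0≈x) _ = inj₂ (trans (sym (zeroˡ y)) (*-congʳ 0≈x))
  *-nonneg {x} (inj₁ _) (inj₂ 0≈y) = inj₂ (trans (sym (zeroʳ x)) (*-congˡ 0≈y))

  x<0⇒0<-x : ∀ {x} → x < 0# → 0# < - x
  x<0⇒0<-x {x} x<0 = <-respʳ-≈ (+-identityˡ (- x)) (x<y⇒0<y-x x<0)

  x*x⁻¹≈1 : ∀ {x} → 0# < x → x * x ⁻¹ ≈ 1#
  x*x⁻¹≈1 0<x = ⁻¹-inverse (λ x≈0 → <-irrefl (sym x≈0) 0<x)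

  x⁻¹-pos : ∀ {x} → 0# < x → 0# < x ⁻¹
  x⁻¹-pos {x} 0<x with compare 0# (x ⁻¹)
  ... | tri< 0<x⁻¹ _ _ = 0<x⁻¹
  ... | tri≈ _ 0≈x⁻¹ _ =
    ⊥-elim (<-irrefl (trans (sym (trans (*-congˡ (sym 0≈x⁻¹)) (zeroʳ x))) (x*x⁻¹≈1 0<x)) 0<1)
  ... | tri> _ _ x⁻¹<0 = ⊥-elim (<-irrefl sum≈0 (+-mono-<-≤ (*-pos 0<x (x<0⇒0<-x x⁻¹<0)) (inj₁ 0<x*x⁻¹)))
    where
    0<x*x⁻¹ : 0# < x * x ⁻¹
    0<x*x⁻¹ = <-respʳ-≈ (sym (x*x⁻¹≈1 0<x)) 0<1
    sum≈0 : 0# + 0# ≈ x * (- x ⁻¹) + x * x ⁻¹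
    sum≈0 = solve 2 (λ x y → (con (+ 0) :+ con (+ 0)) := ((x :* (:- y)) :+ (x :* y))) refl x (x ⁻¹)

  x⁻¹<1 : ∀ {x} → 1# < x → x ⁻¹ < 1#
  x⁻¹<1 {x} 1<x = <-respˡ-≈ (*-identityˡ (x ⁻¹))
    (<-respʳ-≈ (x*x⁻¹≈1 0<x) (*-monoʳ-< (x⁻¹-pos 0<x) 1<x))
    where
    0<x : 0# < x
    0<x = <-trans 0<1 1<x

  *-⁻¹-cancelˡ : ∀ {x} → 0# < x → ∀ y → (x * y) * x ⁻¹ ≈ y
  *-⁻¹-cancelˡ {x} 0<x y = begin-equality
    (x * y) * x ⁻¹   ≈⟨ solve 3 (λ x y z → ((x :* y) :* z) := (y :* (x :* z))) refl x y (x ⁻¹) ⟩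
    y * (x * x ⁻¹)   ≈⟨ *-congˡ (x*x⁻¹≈1 0<x) ⟩
    y * 1#           ≈⟨ *-identityʳ y ⟩
    y                ∎

  <-*-⁻¹ : ∀ {x y t} → 0# < y → x < y * t → x * y ⁻¹ < t
  <-*-⁻¹ 0<y x<yt = <-respʳ-≈ (*-⁻¹-cancelˡ 0<y _) (*-monoʳ-< (x⁻¹-pos 0<y) x<yt)

  *-⁻¹-< : ∀ {x y t} → 0# < y → y * t < x → t < x * y ⁻¹
  *-⁻¹-< 0<y yt<x = <-respˡ-≈ (*-⁻¹-cancelˡ 0<y _) (*-monoʳ-< (x⁻¹-pos 0<y) yt<x)

  fromℕ-nonneg : ∀ m → 0# ≤ fromℕ m
  fromℕ-nonneg zero    = inj₂ refl
  fromℕ-nonneg (suc m) = inj₁ (<-respˡ-≈ (+-identityʳ 0#) (+-mono-<-≤ 0<1 (fromℕ-nonneg m)))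

  fromℕ-pos : ∀ {m} → 0 ℕ.< m → 0# < fromℕ m
  fromℕ-pos {suc m} _ = <-respˡ-≈ (+-identityʳ 0#) (+-mono-<-≤ 0<1 (fromℕ-nonneg m))

  1<fromℕ : ∀ {m} → 2 ℕ.≤ m → 1# < fromℕ m
  1<fromℕ {suc m} (s≤s 1≤m) = <-respˡ-≈ (+-identityʳ 1#) (+-monoʳ-< 1# (fromℕ-pos 1≤m))

  when-yes : ∀ {p} {P : Set p} (d : Dec P) {x} → P → when d x ≈ x
  when-yes (yes _) _ = refl
  when-yes (no ¬p) p = ⊥-elim (¬p p)

  when-no : ∀ {p} {P : Set p} (d : Dec P) {x} → ¬ P → when d x ≈ 0#
  when-no (yes p) ¬p = ⊥-elim (¬p p)
  when-no (no _)  _  = refl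

  when-congʳ : ∀ {p} {P : Set p} (d : Dec P) {x y} → x ≈ y → when d x ≈ when d y
  when-congʳ (yes _) x≈y = x≈y
  when-congʳ (no _)  _   = refl

  when-cong : ∀ {p q} {P : Set p} {Q : Set q} → (P → Q) → (Q → P) →
              (d : Dec P) (e : Dec Q) {x : Carrier} → when d x ≈ when e x
  when-cong P⇒Q Q⇒P (yes p) e = sym (when-yes e (P⇒Q p))
  when-cong P⇒Q Q⇒P (no ¬p) e = sym (when-no e (¬p ∘ Q⇒P))

  when-minus : ∀ {p} {P : Set p} (d : Dec P) x y → when d x - when d y ≈ when d (x - y)
  when-minus (yes _) x y = refl
  when-minus (no _)  x y = -‿inverseʳ 0#

  when-0 : ∀ {p} {P : Set p} (d : Dec P) → when d 0# ≈ 0#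
  when-0 (yes _) = refl
  when-0 (no _)  = refl

  when-mono-≤ : ∀ {p} {P : Set p} (d : Dec P) {x y} → (P → x ≤ y) → when d x ≤ when d y
  when-mono-≤ (yes p) x≤y = x≤y p
  when-mono-≤ (no _)  _   = inj₂ refl

  when-≤-when : ∀ {p q} {P : Set p} {Q : Set q} → (P → Q) → ∀ {x} → 0# ≤ x →
                (d : Dec P) (e : Dec Q) → when d x ≤ when e x
  when-≤-when P⇒Q 0≤x (yes p) (yes _) = inj₂ refl
  when-≤-when P⇒Q 0≤x (yes p) (no ¬q) = ⊥-elim (¬q (P⇒Q p))
  when-≤-when P⇒Q 0≤x (no _)  (yes _) = 0≤x
  when-≤-when P⇒Q 0≤x (no _)  (no _)  = inj₂ refl

  -- Finite sums

  ∑-cong : ∀ {n} {f g : Fin n → Carrier} → (∀ i → f i ≈ g i) → ∑ f ≈ ∑ g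
  ∑-cong {zero}  f≈g = refl
  ∑-cong {suc n} f≈g = +-cong (f≈g zero) (∑-cong (f≈g ∘ suc))

  ∑-zero : ∀ {n} {f : Fin n → Carrier} → (∀ i → f i ≈ 0#) → ∑ f ≈ 0#
  ∑-zero {zero}  f≈0 = refl
  ∑-zero {suc n} f≈0 = trans (+-cong (f≈0 zero) (∑-zero (f≈0 ∘ suc))) (+-identityˡ 0#)

  ∑-const : ∀ {n} x → ∑ {n} (const x) ≈ fromℕ n * x
  ∑-const {zero}  x = sym (zeroˡ x)
  ∑-const {suc n} x = begin-equality
    x + ∑ {n} (const x)   ≈⟨ +-cong (sym (*-identityˡ x)) (∑-const {n} x) ⟩
    1# * x + fromℕ n * x  ≈⟨ distribʳ x 1# (fromℕ n) ⟨
    (1# + fromℕ n) * x    ∎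

  ∑-distrib-+ : ∀ {n} (f g : Fin n → Carrier) → ∑ (λ i → f i + g i) ≈ ∑ f + ∑ g
  ∑-distrib-+ {zero}  f g = sym (+-identityˡ 0#)
  ∑-distrib-+ {suc n} f g = trans (+-congˡ (∑-distrib-+ (f ∘ suc) (g ∘ suc)))
    (solve 4 (λ a b u v → ((a :+ b) :+ (u :+ v)) := ((a :+ u) :+ (b :+ v))) refl _ _ _ _)

  ∑-distribˡ-* : ∀ {n} x (f : Fin n → Carrier) → ∑ (λ i → x * f i) ≈ x * ∑ f
  ∑-distribˡ-* {zero}  x f = sym (zeroʳ x)
  ∑-distribˡ-* {suc n} x f =
    trans (+-congˡ (∑-distribˡ-* x (f ∘ suc))) (sym (distribˡ x _ _))

  ∑-update : ∀ {n} {f g : Fin n → Carrier} p → (∀ i → i ≢ p → g i ≈ f i) → ∑ g ≈ ∑ f + (g p - f p)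
  ∑-update {suc n} {f} {g} zero g≈f = begin-equality
    g zero + ∑ (g ∘ suc)              ≈⟨ +-congˡ (∑-cong (λ i → g≈f (suc i) λ ())) ⟩
    g zero + ∑ (f ∘ suc)              ≈⟨ solve 3 (λ g f s → (g :+ s) := ((f :+ s) :+ (g :- f))) refl (g zero) (f zero) _ ⟩
    (f zero + ∑ (f ∘ suc)) + (g zero - f zero) ∎
  ∑-update {suc n} {f} {g} (suc p) g≈f = begin-equality
    g zero + ∑ (g ∘ suc)                                ≈⟨ +-cong (g≈f zero λ ()) (∑-update p (λ i i≢p → g≈f (suc i) (i≢p ∘ Finₚ.suc-injective))) ⟩
    f zero + (∑ (f ∘ suc) + (g (suc p) - f (suc p)))    ≈⟨ +-assoc _ _ _ ⟨
    (f zero + ∑ (f ∘ suc)) + (g (suc p) - f (suc p))    ∎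

  ∑-update₂ : ∀ {n} {f g : Fin n → Carrier} {p q} → p ≢ q → (∀ i → i ≢ p → i ≢ q → g i ≈ f i) →
              ∑ g ≈ ∑ f + ((g p - f p) + (g q - f q))
  ∑-update₂ {p = zero} {zero} p≢q g≈f = ⊥-elim (p≢q ≡.refl)
  ∑-update₂ {suc n} {f} {g} {zero} {suc q} _ g≈f =
    trans (+-congˡ (∑-update q (λ i i≢q → g≈f (suc i) (λ ()) (i≢q ∘ Finₚ.suc-injective))))
      (solve 5 (λ g f s u v → (g :+ (s :+ (u :- v))) := ((f :+ s) :+ ((g :- f) :+ (u :- v))))
        refl (g zero) (f zero) _ _ _)
  ∑-update₂ {suc n} {f} {g} {suc p} {zero} _ g≈f =
    trans (+-congˡ (∑-update p (λ i i≢p → g≈f (suc i) (i≢p ∘ Finₚ.suc-injective) (λ ()))))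
      (solve 5 (λ g f s u v → (g :+ (s :+ (u :- v))) := ((f :+ s) :+ ((u :- v) :+ (g :- f))))
        refl (g zero) (f zero) _ _ _)
  ∑-update₂ {suc n} {f} {g} {suc p} {suc q} p≢q g≈f =
    trans (+-cong (g≈f zero (λ ()) (λ ())) (∑-update₂ (p≢q ∘ ≡.cong suc) λ i i≢p i≢q →
                    g≈f (suc i) (i≢p ∘ Finₚ.suc-injective) (i≢q ∘ Finₚ.suc-injective)))
      (sym (+-assoc _ _ _))

  ∑-mono-≤ : ∀ {n} {f g : Fin n → Carrier} → (∀ i → f i ≤ g i) → ∑ f ≤ ∑ g
  ∑-mono-≤ {zero}  f≤g = inj₂ refl
  ∑-mono-≤ {suc n} f≤g = +-mono-≤ (f≤g zero) (∑-mono-≤ (f≤g ∘ suc))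

  ∑-mono-< : ∀ {n} {f g : Fin n → Carrier} → (∀ i → f i ≤ g i) → ∀ p → f p < g p → ∑ f < ∑ g
  ∑-mono-< {suc n} f≤g zero    fp<gp = +-mono-<-≤ fp<gp (∑-mono-≤ (f≤g ∘ suc))
  ∑-mono-< {suc n} f≤g (suc p) fp<gp = +-mono-≤-< (f≤g zero) (∑-mono-< (f≤g ∘ suc) p fp<gp)

  -- Partial means

  -- the terms of index in [a, b), counting from 0
  interval : ∀ {m} → ℕ → ℕ → (Fin m → Carrier) → Fin m → Carrier
  interval a b u k = when (a ℕ.≤? toℕ k) (when (toℕ k ℕ.<? b) (u k))

  window : ∀ {m} → ℕ → ℕ → (Fin m → Carrier) → Fin m → Carrier
  window i j u k = when (i ℕ.≤? suc (toℕ k)) (when (suc (toℕ k) ℕ.<? j) (u k))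

  window≈interval : ∀ {m} a b (u : Fin m → Carrier) k → window (suc a) (suc b) u k ≈ interval a b u k
  window≈interval a b u k = trans (when-cong s≤s⁻¹ s≤s (suc a ℕ.≤? suc (toℕ k)) (a ℕ.≤? toℕ k))
    (when-congʳ (a ℕ.≤? toℕ k) (when-cong s<s⁻¹ s<s (suc (toℕ k) ℕ.<? suc b) (toℕ k ℕ.<? b)))

  ∑-interval-const : ∀ {m} a b x → b ℕ.≤ m → ∑ (interval {m} a b (const x)) ≈ fromℕ (b ∸ a) * x
  ∑-interval-const {m} a zero x _ = begin-equality
    ∑ (interval {m} a 0 (const x)) ≈⟨ ∑-zero {m} (λ k → trans
                                        (when-congʳ (a ℕ.≤? toℕ k) (when-no (toℕ k ℕ.<? 0) {x} λ ()))
                                        (when-0 (a ℕ.≤? toℕ k))) ⟩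
    0#                             ≈⟨ zeroˡ x ⟨
    0# * x                         ≡⟨ ≡.cong (λ l → fromℕ l * x) (ℕₚ.0∸n≡0 a) ⟨
    fromℕ (0 ∸ a) * x              ∎
  ∑-interval-const {suc m} zero (suc b) x (s≤s b≤m) = begin-equality
    x + ∑ (interval {suc m} 0 (suc b) (const x) ∘ suc) ≈⟨ +-congˡ (trans (∑-cong shift) (∑-interval-const 0 b x b≤m)) ⟩
    x + fromℕ b * x                                    ≈⟨ +-congʳ (*-identityˡ x) ⟨
    1# * x + fromℕ b * x                               ≈⟨ distribʳ x 1# (fromℕ b) ⟨
    (1# + fromℕ b) * x                                 ∎
    where
    shift : ∀ k → interval 0 (suc b) (const x) (suc k) ≈ interval {m} 0 b (const x) k
    shift k = trans (when-cong (λ _ → z≤n) (λ _ → z≤n) (0 ℕ.≤? suc (toℕ k)) (0 ℕ.≤? toℕ k))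
      (when-congʳ (0 ℕ.≤? toℕ k) (when-cong s<s⁻¹ s<s (suc (toℕ k) ℕ.<? suc b) (toℕ k ℕ.<? b)))
  -- shifted by one index, the interval [a + 1, b + 1) is the window of μ (a + 1) (b + 1)
  ∑-interval-const {suc m} (suc a) (suc b) x (s≤s b≤m) = begin-equality
    0# + ∑ (interval {suc m} (suc a) (suc b) (const x) ∘ suc) ≈⟨ +-identityˡ _ ⟩
    ∑ (window {m} (suc a) (suc b) (const x))                  ≈⟨ ∑-cong {m} (window≈interval a b (const x)) ⟩
    ∑ (interval {m} a b (const x))                            ≈⟨ ∑-interval-const a b x b≤m ⟩
    fromℕ (b ∸ a) * x                                         ∎

  ∑-window-const : ∀ {m} a b x → b ℕ.≤ m → ∑ (window {m} (suc a) (suc b) (const x)) ≈ fromℕ (b ∸ a) * x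
  ∑-window-const {m} a b x b≤m = trans (∑-cong {m} (window≈interval a b (const x))) (∑-interval-const a b x b≤m)

  ∑-window-< : ∀ {m} a b {u v : Fin m → Carrier} → a ℕ.< b → b ℕ.≤ m →
               (∀ k → suc a ℕ.≤ suc (toℕ k) → suc (toℕ k) ℕ.< suc b → u k < v k) →
               ∑ (window (suc a) (suc b) u) < ∑ (window (suc a) (suc b) v)
  ∑-window-< {m} a b {u} {v} a<b b≤m u<v =
    ∑-mono-< (λ k → when-mono-≤ (suc a ℕ.≤? suc (toℕ k)) λ a≤k →
                    when-mono-≤ (suc (toℕ k) ℕ.<? suc b) λ k<b → inj₁ (u<v k a≤k k<b))
             k₀ (<-respʳ-≈ (sym (window-in v)) (<-respˡ-≈ (sym (window-in u)) (u<v k₀ a≤k₀ k₀<b)))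
    where
    a<m : a ℕ.< m
    a<m = ℕₚ.<-≤-trans a<b b≤m
    k₀ : Fin m
    k₀ = Fin.fromℕ< a<m
    a≤k₀ : suc a ℕ.≤ suc (toℕ k₀)
    a≤k₀ = s≤s (ℕₚ.≤-reflexive (≡.sym (Finₚ.toℕ-fromℕ< a<m)))
    k₀<b : suc (toℕ k₀) ℕ.< suc b
    k₀<b = s<s (≡.subst (ℕ._< b) (≡.sym (Finₚ.toℕ-fromℕ< a<m)) a<b)
    window-in : ∀ w → window (suc a) (suc b) w k₀ ≈ w k₀
    window-in w = trans (when-yes (suc a ℕ.≤? suc (toℕ k₀)) a≤k₀) (when-yes (suc (toℕ k₀) ℕ.<? suc b) k₀<b)

  module PartialSums {n} (c : Fin n → Carrier) where
    open Ordering c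

    s-mono : (∀ i → 0# ≤ c i) → ∀ {i j} → toℕ i ℕ.≤ toℕ j → s i ≤ s j
    s-mono 0≤c {i} {j} i≤j = ∑-mono-≤ λ l →
      when-≤-when (λ l≤i → ℕₚ.≤-trans l≤i i≤j) (0≤c l) (toℕ l ℕ.≤? toℕ i) (toℕ l ℕ.≤? toℕ j)

    μ<  : ∀ {t} i j → 1 ℕ.≤ i → i ℕ.< j → j ℕ.≤ suc n →
          (∀ k → i ℕ.≤ suc (toℕ k) → suc (toℕ k) ℕ.< j → s k < t) → μ i j < t
    μ< {t} (suc a) (suc b) _ (s<s a<b) (s≤s b≤n) s<t = <-*-⁻¹ (fromℕ-pos (ℕₚ.m<n⇒0<n∸m a<b))
      (<-respʳ-≈ (∑-window-const a b t b≤n) (∑-window-< a b a<b b≤n s<t))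

    >μ  : ∀ {t} i j → 1 ℕ.≤ i → i ℕ.< j → j ℕ.≤ suc n →
          (∀ k → i ℕ.≤ suc (toℕ k) → suc (toℕ k) ℕ.< j → t < s k) → t < μ i j
    >μ {t} (suc a) (suc b) _ (s<s a<b) (s≤s b≤n) t<s = *-⁻¹-< (fromℕ-pos (ℕₚ.m<n⇒0<n∸m a<b))
      (<-respˡ-≈ (∑-window-const a b t b≤n) (∑-window-< a b a<b b≤n t<s))

  -- Adjacent swaps and optimal orderings

  module Deviation {n} (0<n : 0# < fromℕ n) where

    mean : (Fin n → Carrier) → Carrier
    mean x = ∑ x * fromℕ n ⁻¹

    deviation : (Fin n → Carrier) → Carrier
    deviation x = ∑ (λ k → sq (x k - mean x))

    fromℕ*mean : ∀ x → fromℕ n * mean x ≈ ∑ x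
    fromℕ*mean x = trans (sym (*-assoc _ _ _)) (*-⁻¹-cancelˡ 0<n (∑ x))

    deviation-expand : ∀ x → deviation x ≈ ∑ (sq ∘ x) - (mean x * ∑ x)
    deviation-expand x = begin-equality
      ∑ (λ k → sq (x k - m))                                         ≈⟨ ∑-cong (λ k → square (x k)) ⟩
      ∑ (λ k → sq (x k) + (m * m + (- (m + m)) * x k))               ≈⟨ ∑-distrib-+ (sq ∘ x) (λ k → m * m + (- (m + m)) * x k) ⟩
      ∑ (sq ∘ x) + ∑ (λ k → m * m + (- (m + m)) * x k)               ≈⟨ +-congˡ (∑-distrib-+ (const (m * m)) (λ k → (- (m + m)) * x k)) ⟩
      ∑ (sq ∘ x) + (∑ {n} (const (m * m)) + ∑ (λ k → (- (m + m)) * x k))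
        ≈⟨ +-congˡ (+-cong (∑-const {n} (m * m)) (∑-distribˡ-* _ x)) ⟩
      ∑ (sq ∘ x) + (fromℕ n * (m * m) + (- (m + m)) * ∑ x)           ≈⟨ +-congˡ (+-congʳ n*m²≈m*∑x) ⟩
      ∑ (sq ∘ x) + (m * ∑ x + (- (m + m)) * ∑ x)
        ≈⟨ solve 3 (λ a b m → (a :+ ((m :* b) :+ ((:- (m :+ m)) :* b))) := (a :- (m :* b))) refl _ _ _ ⟩
      ∑ (sq ∘ x) - (m * ∑ x)                                         ∎
      where
      m : Carrier
      m = mean x
      square : ∀ y → sq (y - m) ≈ sq y + (m * m + (- (m + m)) * y)
      square y = solve 2 (λ y m → ((y :- m) :* (y :- m)) := ((y :* y) :+ ((m :* m) :+ ((:- (m :+ m)) :* y)))) refl y m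
      n*m²≈m*∑x : fromℕ n * (m * m) ≈ m * ∑ x
      n*m²≈m*∑x = trans (solve 2 (λ n m → (n :* (m :* m)) := (m :* (n :* m))) refl (fromℕ n) m)
                        (*-congˡ (fromℕ*mean x))

    deviation-update : ∀ {x y : Fin n → Carrier} p d → (∀ i → i ≢ p → y i ≈ x i) → y p ≈ x p + d →
      deviation y ≈ deviation x + ((d * (x p - mean x) + d * (x p - mean x)) + ((d * d) - (fromℕ n ⁻¹ * (d * d))))
    deviation-update {x} {y} p d y≈x yp≈xp+d = begin-equality
      deviation y                                                   ≈⟨ deviation-expand y ⟩
      ∑ (sq ∘ y) - (mean y * ∑ y)                                   ≈⟨ +-cong ∑sq-y (-‿cong (*-cong (*-congʳ ∑y) ∑y)) ⟩
      (A + (sq (x p + d) - sq (x p))) - (((B + d) * n⁻¹) * (B + d))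
        ≈⟨ solve 5 (λ a b u d i → ((a :+ (((u :+ d) :* (u :+ d)) :- (u :* u))) :- (((b :+ d) :* i) :* (b :+ d)))
                             := ((a :- ((b :* i) :* b)) :+ (((d :* (u :- (b :* i))) :+ (d :* (u :- (b :* i))))
                                                            :+ ((d :* d) :- (i :* (d :* d))))))
                   refl A B (x p) d n⁻¹ ⟩
      (A - (mean x * B)) + ((d * (x p - mean x) + d * (x p - mean x)) + ((d * d) - (n⁻¹ * (d * d))))
        ≈⟨ +-congʳ (deviation-expand x) ⟨
      deviation x + ((d * (x p - mean x) + d * (x p - mean x)) + ((d * d) - (n⁻¹ * (d * d)))) ∎
      where
      A B n⁻¹ : Carrier
      A = ∑ (sq ∘ x)
      B = ∑ x
      n⁻¹ = fromℕ n ⁻¹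
      ∑y : ∑ y ≈ B + d
      ∑y = trans (∑-update p y≈x)
        (+-congˡ (trans (+-congʳ yp≈xp+d) (solve 2 (λ u d → ((u :+ d) :- u) := d) refl (x p) d)))
      ∑sq-y : ∑ (sq ∘ y) ≈ A + (sq (x p + d) - sq (x p))
      ∑sq-y = trans (∑-update p (λ i i≢p → *-cong (y≈x i i≢p) (y≈x i i≢p)))
        (+-congˡ (+-congʳ (*-cong yp≈xp+d yp≈xp+d)))

  module AdjacentSwap {n} (c : Fin n → Carrier) {p q : Fin n} (q≡1+p : toℕ q ≡ suc (toℕ p)) where
    open Ordering c
    module Swapped = Ordering (c ∘ PC.transpose p q)

    p≢q : p ≢ q
    p≢q = adjacent⇒≢ q≡1+p

    q≰p : ¬ (toℕ q ℕ.≤ toℕ p)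
    q≰p q≤p = ℕₚ.1+n≰n (≡.subst (ℕ._≤ toℕ p) q≡1+p q≤p)

    transpose-p : PC.transpose p q p ≡ q
    transpose-p rewrite dec-true (p Fin.≟ p) ≡.refl = ≡.refl

    transpose-q : PC.transpose p q q ≡ p
    transpose-q rewrite dec-false (q Fin.≟ p) (p≢q ∘ ≡.sym) | dec-true (q Fin.≟ q) ≡.refl = ≡.refl

    transpose-other : ∀ j → j ≢ p → j ≢ q → PC.transpose p q j ≡ j
    transpose-other j j≢p j≢q rewrite dec-false (j Fin.≟ p) j≢p | dec-false (j Fin.≟ q) j≢q = ≡.refl

    swapped-s : ∀ i → Swapped.s i ≈ s i + (when (toℕ p ℕ.≤? toℕ i) (c q - c p) + when (toℕ q ℕ.≤? toℕ i) (c p - c q))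
    swapped-s i = trans (∑-update₂ p≢q unchanged) (+-congˡ (+-cong (moved p q transpose-p) (moved q p transpose-q)))
      where
      unchanged : ∀ j → j ≢ p → j ≢ q →
                  when (toℕ j ℕ.≤? toℕ i) (c (PC.transpose p q j)) ≈ when (toℕ j ℕ.≤? toℕ i) (c j)
      unchanged j j≢p j≢q = when-congʳ (toℕ j ℕ.≤? toℕ i) (reflexive (≡.cong c (transpose-other j j≢p j≢q)))
      moved : ∀ j k → PC.transpose p q j ≡ k →
              when (toℕ j ℕ.≤? toℕ i) (c (PC.transpose p q j)) - when (toℕ j ℕ.≤? toℕ i) (c j)
                ≈ when (toℕ j ℕ.≤? toℕ i) (c k - c j)
      moved j k eq = trans (+-congʳ (when-congʳ (toℕ j ℕ.≤? toℕ i) (reflexive (≡.cong c eq))))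
                           (when-minus (toℕ j ℕ.≤? toℕ i) (c k) (c j))

    swapped-s-p : Swapped.s p ≈ s p + (c q - c p)
    swapped-s-p = trans (swapped-s p) (+-congˡ (trans
      (+-cong (when-yes (toℕ p ℕ.≤? toℕ p) ℕₚ.≤-refl) (when-no (toℕ q ℕ.≤? toℕ p) q≰p)) (+-identityʳ _)))

    swapped-s-other : ∀ i → i ≢ p → Swapped.s i ≈ s i
    swapped-s-other i i≢p = trans (swapped-s i) (trans (+-congˡ (changes (ℕₚ.<-cmp (toℕ i) (toℕ p)))) (+-identityʳ _))
      where
      changes : Tri (toℕ i ℕ.< toℕ p) (toℕ i ≡ toℕ p) (toℕ p ℕ.< toℕ i) →
                when (toℕ p ℕ.≤? toℕ i) (c q - c p) + when (toℕ q ℕ.≤? toℕ i) (c p - c q) ≈ 0#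
      changes (tri< i<p _ _) = trans (+-cong (when-no (toℕ p ℕ.≤? toℕ i) (ℕₚ.<⇒≱ i<p))
        (when-no (toℕ q ℕ.≤? toℕ i) λ q≤i → ℕₚ.<⇒≱ i<p (ℕₚ.≤-trans (ℕₚ.n≤1+n _) (≡.subst (ℕ._≤ toℕ i) q≡1+p q≤i))))
        (+-identityʳ 0#)
      changes (tri≈ _ i≡p _) = ⊥-elim (i≢p (Finₚ.toℕ-injective i≡p))
      changes (tri> _ _ p<i) = trans (+-cong (when-yes (toℕ p ℕ.≤? toℕ i) (ℕₚ.<⇒≤ p<i))
        (when-yes (toℕ q ℕ.≤? toℕ i) (≡.subst (ℕ._≤ toℕ i) (≡.sym q≡1+p) p<i)))
        (solve 2 (λ u v → ((u :- v) :+ (v :- u)) := con (+ 0)) refl (c q) (c p))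

    swap-increases-f : 1# < fromℕ n → 0# < sq (c q - c p) → 0# ≤ ((c q - c p) * (s p - S̄)) → f < Swapped.f
    swap-increases-f 1<n 0<d² 0≤d[sp-S̄] = *-monoʳ-< (x⁻¹-pos 0<n) (begin-strict
      deviation s                                   ≈⟨ solve 1 (λ v → v := (v :+ ((con (+ 0) :+ con (+ 0)) :+ con (+ 0)))) refl _ ⟩
      deviation s + ((0# + 0#) + 0#)                <⟨ +-monoʳ-< _ (+-mono-≤-< (+-mono-≤ 0≤d[sp-S̄] 0≤d[sp-S̄]) 0<gain) ⟩
      deviation s + ((d * (s p - S̄) + d * (s p - S̄)) + (sq d - (fromℕ n ⁻¹ * sq d)))
                                                    ≈⟨ deviation-update p d swapped-s-other swapped-s-p ⟨
      deviation Swapped.s                           ∎)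
      where
      0<n : 0# < fromℕ n
      0<n = <-trans 0<1 1<n
      open Deviation {n} 0<n
      d : Carrier
      d = c q - c p
      0<gain : 0# < (sq d - (fromℕ n ⁻¹ * sq d))
      0<gain = x<y⇒0<y-x (<-respʳ-≈ (*-identityˡ (sq d)) (*-monoʳ-< 0<d² (x⁻¹<1 1<n)))

  module Optimality {n} (a : Fin n → Carrier) (π : Permutation′ n) (optimal : Optimal a π) (1<n : 1# < fromℕ n) where
    open Ordering (reorder a π)

    no-improving-swap : ∀ p q → ¬ (f < Ordering.f (reorder a π ∘ PC.transpose p q))
    no-improving-swap p q f<f′ = <-irrefl refl (<-≤-trans f<f′ (optimal (Perm.transpose p q Perm.∘ₚ π)))

    ascent⇒below-mean : ∀ {p q} → toℕ q ≡ suc (toℕ p) → reorder a π p < reorder a π q → s p < S̄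
    ascent⇒below-mean {p} {q} q≡1+p cp<cq with <-or-≥ (s p) S̄
    ... | inj₁ sp<S̄ = sp<S̄
    ... | inj₂ S̄≤sp = ⊥-elim (no-improving-swap p q
          (swap-increases-f 1<n (*-pos 0<d 0<d) (*-nonneg (inj₁ 0<d) (x≤y⇒0≤y-x S̄≤sp))))
      where
      open AdjacentSwap (reorder a π) q≡1+p
      0<d : 0# < (reorder a π q - reorder a π p)
      0<d = x<y⇒0<y-x cp<cq

    descent⇒above-mean : ∀ {p q} → toℕ q ≡ suc (toℕ p) → reorder a π q < reorder a π p → S̄ < s p
    descent⇒above-mean {p} {q} q≡1+p cq<cp with <-or-≥ S̄ (s p)
    ... | inj₁ S̄<sp = S̄<sp
    ... | inj₂ sp≤S̄ = ⊥-elim (no-improving-swap p q (swap-increases-f 1<n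
          (<-respʳ-≈ (flip² (C q) (C p) (C q) (C p)) (*-pos 0<e 0<e))
          (≤-respʳ-≈ (flip² (C q) (C p) (s p) S̄) (*-nonneg (inj₁ 0<e) (x≤y⇒0≤y-x sp≤S̄)))))
      where
      open AdjacentSwap (reorder a π) q≡1+p
      C : Fin n → Carrier
      C = reorder a π
      0<e : 0# < (C p - C q)
      0<e = x<y⇒0<y-x cq<cp
      flip² : ∀ u v x y → (v - u) * (y - x) ≈ (u - v) * (x - y)
      flip² u v x y = solve 4 (λ u v x y → ((v :- u) :* (y :- x)) := ((u :- v) :* (x :- y))) refl u v x y

  module _ {n} {a : Fin n → Carrier} (increasing : ∀ i j → toℕ i ℕ.< toℕ j → a i < a j)
           {last : Fin n} (last≡n-1 : toℕ last ≡ n ∸ 1) where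

    below-last : ∀ i → i ≢ last → a i < a last
    below-last i i≢last = increasing i last (ℕₚ.≤∧≢⇒< i≤last (i≢last ∘ Finₚ.toℕ-injective))
      where
      i≤last : toℕ i ℕ.≤ toℕ last
      i≤last = ≡.subst (toℕ i ℕ.≤_) (≡.trans (ℕₚ.pred[m∸n]≡m∸[1+n] n 0) (≡.sym last≡n-1)) (Finₚ.toℕ≤pred[n] i)

    reorder-max : ∀ (π : Permutation′ n) {k} → reorder a π k ≈ a last → ∀ i → i ≢ k → reorder a π i < reorder a π k
    reorder-max π {k} ck≈max i i≢k = <-respʳ-≈ (sym ck≈max) (below-last (π ⟨$⟩ʳ i) πi≢last)
      where
      πk≡last : π ⟨$⟩ʳ k ≡ last
      πk≡last with π ⟨$⟩ʳ k Fin.≟ last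
      ... | yes πk≡last = πk≡last
      ... | no  πk≢last = ⊥-elim (<-irrefl ck≈max (below-last _ πk≢last))
      πi≢last : π ⟨$⟩ʳ i ≢ last
      πi≢last πi≡last = i≢k (Injection.injective (Inverse⇒Injection π) (≡.trans πi≡last (≡.sym πk≡last)))

open import Data.Nat using (_≤_; _<_)

proposition3 : ∀ {c ℓ₁ ℓ₂} (F : OrderedField c ℓ₁ ℓ₂) →
    let open OrderedField F hiding (_≤_) renaming (_<_ to _<F_) in
    (n : ℕ) → 3 ≤ n →
    (a : Fin n → Carrier) →
    (∀ i → 0# <F a i) →
    (∀ i j → toℕ i < toℕ j → a i <F a j) →
    (π : Permutation′ n) → Optimal a π →
    (k : Fin n) → 1 ≤ toℕ k → suc (toℕ k) < n →
    (last : Fin n) → toℕ last ≡ n ∸ 1 →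
    reorder a π k ≈ a last →
    let open Ordering (reorder a π) in
    (∀ i j → 1 ≤ i → i < j → j ≤ suc (toℕ k) → μ i j <F S̄) ×
    (∀ i j → suc (toℕ k) ≤ i → i < j → j ≤ n → S̄ <F μ i j)
proposition3 F n 3≤n a 0<a increasing π optimal k 1≤k 1+k<n last last≡n-1 ck≈max = below , above
  where
  open OrderedField F using (reorder; module Ordering) renaming (_<_ to _<F_; _≤_ to _≤F_)
  open Ordering (reorder a π)
  open Optimality F a π optimal (1<fromℕ F (ℕₚ.≤-trans (ℕₚ.n≤1+n 2) 3≤n))
  open PartialSums F (reorder a π)

  max : ∀ i → i ≢ k → reorder a π i <F reorder a π k
  max = reorder-max F increasing last≡n-1 π ck≈max

  mono : ∀ {i j} → toℕ i ≤ toℕ j → s i ≤F s j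
  mono = s-mono (λ i → inj₁ (0<a _))

  before-k : ∀ l → toℕ l < toℕ k → s l <F S̄
  before-k l l<k with predecessor k 1≤k
  ... | k′ , k≡1+k′ = ≤-<-trans F (mono (s≤s⁻¹ (≡.subst (suc (toℕ l) ≤_) k≡1+k′ l<k)))
                                  (ascent⇒below-mean k≡1+k′ (max k′ (adjacent⇒≢ k≡1+k′)))

  from-k : ∀ l → toℕ k ≤ toℕ l → S̄ <F s l
  from-k l k≤l with successor k 1+k<n
  ... | k′ , k′≡1+k = <-≤-trans F (descent⇒above-mean k′≡1+k (max k′ (adjacent⇒≢ k′≡1+k ∘ ≡.sym))) (mono k≤l)

  below : ∀ i j → 1 ≤ i → i < j → j ≤ suc (toℕ k) → μ i j <F S̄
  below i j 1≤i i<j j≤1+k = μ< i j 1≤i i<j (ℕₚ.≤-trans j≤1+k (ℕₚ.m≤n⇒m≤1+n (ℕₚ.<⇒≤ 1+k<n)))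
    λ l _ 1+l<j → before-k l (s≤s⁻¹ (ℕₚ.<-≤-trans 1+l<j j≤1+k))

  above : ∀ i j → suc (toℕ k) ≤ i → i < j → j ≤ n → S̄ <F μ i j
  above i j 1+k≤i i<j j≤n = >μ i j (ℕₚ.≤-trans (s≤s z≤n) 1+k≤i) i<j (ℕₚ.m≤n⇒m≤1+n j≤n)
    λ l i≤1+l _ → from-k l (s≤s⁻¹ (ℕₚ.≤-trans 1+k≤i i≤1+l))
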